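{- For every finite simple graph $G$, the degree of $Q(G;x,y)$ with respect to $y$ equals the independence number $\alpha(G)$ (the maximum cardinality of an independent vertex set of $G$).
   Context: For $G=(V,E)$, $Q(G;x,y)=\sum_{X\subseteq V}x^{|X|}y^{k(G[X])}$, where $G[X]$ is the induced subgraph and $k$ the number of connected components (the null graph has $k=0$). -}

module Defs where

open import Data.Nat using (ℕ; zero; suc; _+_; _≤_; _<_)
open import Data.Bool using (Bool; true; false; _∧_; _∨_; not; if_then_else_)
open import Data.Fin using (Fin; toℕ)
open import Data.Fin.Properties using (_<?_)
open import Data.Vec using (Vec; []; _∷_; lookup; count)
open import Data.List using (List; []; _∷_; map; _++_; filter; length; allFin)
open import Data.Bool.ListAction using (any; all)
open import Data.Product using (Σ; _×_; ∃)
open import Relation.Binary.PropositionalEquality using (_≡_; _≢_)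
open import Relation.Nullary.Decidable using (⌊_⌋)

record Graph (n : ℕ) : Set where
  field
    adj       : Fin n → Fin n → Bool
    adj-sym   : ∀ u v → adj u v ≡ adj v u
    adj-irref : ∀ v → adj v v ≡ false
open Graph public

VSet : ℕ → Set
VSet n = Vec Bool n

_∈ᵇ_ : ∀ {n} → Fin n → VSet n → Bool
v ∈ᵇ X = lookup X v

card : ∀ {n} → VSet n → ℕ
card X = count (λ b → b Data.Bool.≟ true) X

allSubsets : (n : ℕ) → List (VSet n)
allSubsets zero = [] ∷ []
allSubsets (suc n) = map (false ∷_) (allSubsets n) ++ map (true ∷_) (allSubsets n)

reachWithin : ∀ {n} → Graph n → VSet n → ℕ → Fin n → Fin n → Bool
reachWithin G X zero u v =
  (u ∈ᵇ X) ∧ (v ∈ᵇ X) ∧ ⌊ Data.Fin._≟_ u v ⌋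
reachWithin {n} G X (suc m) u v =
  reachWithin G X m u v ∨
  any (λ w → reachWithin G X m u w ∧ adj G w v ∧ (v ∈ᵇ X)) (allFin n)

-- u and v lie in the same connected component of G[X]
-- (a walk with at most n edges suffices in a graph on n vertices).
connectedIn : ∀ {n} → Graph n → VSet n → Fin n → Fin n → Bool
connectedIn {n} G X u v = reachWithin G X n u v

-- k(G[X]): number of connected components of G[X], counted by choosing in
-- every component its least vertex (w.r.t. the order of Fin n).
-- The null graph (X = ∅) has 0 components.
components : ∀ {n} → Graph n → VSet n → ℕ
components {n} G X =
  length (filter (λ v → Data.Bool._≟_
                   ((v ∈ᵇ X) ∧
                     all (λ u → not (⌊ u <? v ⌋ ∧ connectedIn G X u v)) (allFin n))
                   true)
                 (allFin n))

-- Q(G;x,y) = Σ_{X ⊆ V} x^{|X|} y^{k(G[X])}, represented by its coefficients: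
-- coefficient of x^i y^j = number of X with |X| = i and k(G[X]) = j.
Qcoeff : ∀ {n} → Graph n → ℕ → ℕ → ℕ
Qcoeff {n} G i j =
  length (filter (λ X → Data.Bool._≟_
                   (⌊ Data.Nat._≟_ (card X) i ⌋ ∧ ⌊ Data.Nat._≟_ (components G X) j ⌋)
                   true)
                 (allSubsets n))

IsDegreeY : (ℕ → ℕ → ℕ) → ℕ → Set
IsDegreeY c d = (∃ λ i → c i d ≢ 0) × (∀ i j → d < j → c i j ≡ 0)

Independent : ∀ {n} → Graph n → VSet n → Set
Independent G X = ∀ u v → u ∈ᵇ X ≡ true → v ∈ᵇ X ≡ true → adj G u v ≡ false

IsIndependenceNumber : ∀ {n} → Graph n → ℕ → Set
IsIndependenceNumber {n} G a =
  (Σ (VSet n) λ X → Independent G X × card X ≡ a) ×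
  (∀ X → Independent G X → card X ≤ a)

-- The coefficient of x^i y^j in Q counts the vertex sets X with |X| = i and
-- k(G[X]) = j, so the theorem amounts to two facts about k(G[X]):
--   (1) if X is independent then every vertex of X is its own component of
--       G[X], hence k(G[X]) = |X|; a maximum independent set therefore gives
--       a nonzero coefficient of x^α y^α;
--   (2) for every X, the leaders of G[X] (the least vertex of each component,
--       which is how components are counted) form an independent set, since
--       two adjacent vertices of X lie in one component; hence k(G[X]) ≤ α
--       and all coefficients of y^j with j > α vanish.
module Submission where

open import Defs
open import Data.Nat using (ℕ; zero; suc; _≤_; _<_; _≤′_; ≤′-refl; ≤′-step; s≤s; z≤n)
  renaming (_≟_ to _≟ℕ_)
open import Data.Nat.Properties using (≤⇒≤′; <-irrefl; ≤-<-trans)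
open import Data.Bool using (Bool; true; false; _∧_; _∨_; not; _≟_)
open import Data.Bool.Properties using (∧-zeroʳ; ∨-zeroʳ; T-≡)
open import Data.Bool.ListAction using (any; all)
open import Data.Fin using (Fin) renaming (zero to fzero; suc to fsuc)
import Data.Fin as Fin
open import Data.Fin.Properties using (_<?_; <-cmp) renaming (<-irrefl to Fin-<-irrefl)
open import Data.Vec using ([]; _∷_; lookup; tabulate)
open import Data.Vec.Properties using (tabulate∘lookup; lookup∘tabulate; tabulate-cong)
import Data.List as List
open import Data.List using (List; map; filter; length; allFin)
open import Data.List.Properties using (filter-some; filter-none)
open import Data.List.Relation.Unary.Any using (here; satisfied)
open import Data.List.Relation.Unary.Any.Properties using (any⁺; any⁻)
open import Data.List.Relation.Unary.All using (universal) renaming (lookup to All-lookup)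
open import Data.List.Relation.Unary.All.Properties using (all⁺; all⁻)
open import Data.List.Membership.Propositional using (_∈_; lose)
open import Data.List.Membership.Propositional.Properties
  using (∈-++⁺ˡ; ∈-++⁺ʳ; ∈-map⁺; ∈-allFin)
open import Data.Product using (_×_; ∃; _,_; proj₁; proj₂)
open import Data.Sum using (_⊎_; inj₁; inj₂)
open import Function.Bundles using (Equivalence)
open import Relation.Binary using (tri<; tri≈; tri>)
open import Relation.Binary.PropositionalEquality
open import Relation.Nullary using (Dec; yes; ¬_; contradiction)
open import Relation.Nullary.Decidable using (⌊_⌋; isYes≗does; dec-true; dec-false)

private
  variable
    A : Set

∧-true : ∀ {a b} → a ∧ b ≡ true → a ≡ true × b ≡ true
∧-true {true} {true} _ = refl , refl

∨-true : ∀ {a b} → a ∨ b ≡ true → a ≡ true ⊎ b ≡ true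
∨-true {true}  _ = inj₁ refl
∨-true {false} p = inj₂ p

true≢false : true ≢ false
true≢false ()

⌊⌋-true : (d : Dec A) → A → ⌊ d ⌋ ≡ true
⌊⌋-true d a = trans (isYes≗does d) (dec-true d a)

⌊⌋-sound : (d : Dec A) → ⌊ d ⌋ ≡ true → A
⌊⌋-sound (yes a) _ = a

⌊⌋-false : (d : Dec A) → ¬ A → ⌊ d ⌋ ≡ false
⌊⌋-false d ¬a = trans (isYes≗does d) (dec-false d ¬a)

any-elim : (p : A → Bool) (xs : List A) → any p xs ≡ true → ∃ λ x → p x ≡ true
any-elim p xs e with x , px ← satisfied (any⁻ p xs (Equivalence.from T-≡ e)) =
  x , Equivalence.to T-≡ px

any-intro : (p : A → Bool) {x : A} {xs : List A} → x ∈ xs → p x ≡ true → any p xs ≡ true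
any-intro p x∈xs px = Equivalence.to T-≡ (any⁺ p (lose x∈xs (Equivalence.from T-≡ px)))

all-elim : (p : A → Bool) {x : A} {xs : List A} → all p xs ≡ true → x ∈ xs → p x ≡ true
all-elim p {xs = xs} e x∈xs =
  Equivalence.to T-≡ (All-lookup (all⁺ p xs (Equivalence.from T-≡ e)) x∈xs)

all-intro : (p : A → Bool) (xs : List A) → (∀ x → p x ≡ true) → all p xs ≡ true
all-intro p xs h = Equivalence.to T-≡ (all⁻ p (universal (λ x → Equivalence.from T-≡ (h x)) xs))

count-tabulate : ∀ {n} (g : Fin n → A) (f : A → Bool) →
  length (filter (λ x → f x ≟ true) (List.tabulate g)) ≡ card (tabulate (λ i → f (g i)))
count-tabulate {n = zero}  g f = refl
count-tabulate {n = suc n} g f with f (g fzero)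
... | true  = cong suc (count-tabulate (λ i → g (fsuc i)) f)
... | false = count-tabulate (λ i → g (fsuc i)) f

∈-allSubsets : ∀ {n} (X : VSet n) → X ∈ allSubsets n
∈-allSubsets [] = here refl
∈-allSubsets {suc n} (false ∷ X) = ∈-++⁺ˡ (∈-map⁺ (false ∷_) (∈-allSubsets X))
∈-allSubsets {suc n} (true ∷ X) =
  ∈-++⁺ʳ (map (false ∷_) (allSubsets n)) (∈-map⁺ (true ∷_) (∈-allSubsets X))

module Reachability {n : ℕ} (G : Graph n) (X : VSet n) where

  Reach : ℕ → Fin n → Fin n → Set
  Reach m u v = reachWithin G X m u v ≡ true

  reach-start : ∀ m {u v} → Reach m u v → u ∈ᵇ X ≡ true
  reach-start zero    r = proj₁ (∧-true r)
  reach-start (suc m) r with ∨-true r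
  ... | inj₁ r′ = reach-start m r′
  ... | inj₂ e with w , step ← any-elim _ (allFin n) e = reach-start m (proj₁ (∧-true step))

  reach-mono : ∀ {m k u v} → m ≤′ k → Reach m u v → Reach k u v
  reach-mono ≤′-refl r = r
  reach-mono (≤′-step m≤k) r rewrite reach-mono m≤k r = refl

  edge-reach : ∀ {u v} → u ∈ᵇ X ≡ true → v ∈ᵇ X ≡ true → adj G u v ≡ true → Reach 1 u v
  edge-reach {u} {v} uX vX uv =
    trans (cong (reachWithin G X 0 u v ∨_) (any-intro _ (∈-allFin u) step)) (∨-zeroʳ _)
    where
    stay : Reach 0 u u
    stay rewrite uX = ⌊⌋-true (u Fin.≟ u) refl
    step : reachWithin G X 0 u u ∧ adj G u v ∧ (v ∈ᵇ X) ≡ true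
    step rewrite stay | uv | vX = refl

  edge-connected : ∀ {u v} → u ∈ᵇ X ≡ true → v ∈ᵇ X ≡ true → adj G u v ≡ true →
    connectedIn G X u v ≡ true
  edge-connected {u} uX vX uv = reach-mono (≤⇒≤′ (one≤ u)) (edge-reach uX vX uv)
    where
    one≤ : ∀ {k} → Fin k → 1 ≤ k
    one≤ fzero    = s≤s z≤n
    one≤ (fsuc _) = s≤s z≤n

  independent-reach : Independent G X → ∀ m {u v} → Reach m u v → u ≡ v
  independent-reach ind zero {u} {v} r =
    ⌊⌋-sound (u Fin.≟ v) (proj₂ (∧-true {v ∈ᵇ X} (proj₂ (∧-true {u ∈ᵇ X} r))))
  independent-reach ind (suc m) {u} {v} r with ∨-true r
  ... | inj₁ r′ = independent-reach ind m r′
  ... | inj₂ e with w , step ← any-elim _ (allFin n) e with ∧-true step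
  ... | uw , wv∧vX with ∧-true wv∧vX
  ... | wv , vX = contradiction (trans (sym wv) (ind w v wX vX)) true≢false
    where
    wX : w ∈ᵇ X ≡ true
    wX = subst (λ z → z ∈ᵇ X ≡ true) (independent-reach ind m uw) (reach-start m uw)

open Reachability

isLeader : ∀ {n} → Graph n → VSet n → Fin n → Bool
isLeader {n} G X v = (v ∈ᵇ X) ∧ all (λ u → not (⌊ u <? v ⌋ ∧ connectedIn G X u v)) (allFin n)

leaders : ∀ {n} → Graph n → VSet n → VSet n
leaders G X = tabulate (isLeader G X)

components-leaders : ∀ {n} (G : Graph n) (X : VSet n) → components G X ≡ card (leaders G X)
components-leaders G X = count-tabulate (λ v → v) (isLeader G X)

leader-minimal : ∀ {n} (G : Graph n) (X : VSet n) {w v : Fin n} →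
  isLeader G X v ≡ true → w ∈ᵇ X ≡ true → w Fin.< v → adj G w v ≡ false
leader-minimal {n} G X {w} {v} lv wX w<v with adj G w v in wv
... | false = refl
... | true  = contradiction (trans (sym no-earlier) earlier) true≢false
  where
  vX : v ∈ᵇ X ≡ true
  vX = proj₁ (∧-true lv)
  no-earlier : not (⌊ w <? v ⌋ ∧ connectedIn G X w v) ≡ true
  no-earlier = all-elim _ (proj₂ (∧-true {v ∈ᵇ X} lv)) (∈-allFin w)
  earlier : not (⌊ w <? v ⌋ ∧ connectedIn G X w v) ≡ false
  earlier rewrite ⌊⌋-true (w <? v) w<v | edge-connected G X wX vX wv = refl

leaders-isLeader : ∀ {n} (G : Graph n) (X : VSet n) {v : Fin n} →
  v ∈ᵇ leaders G X ≡ true → isLeader G X v ≡ true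
leaders-isLeader G X {v} = trans (sym (lookup∘tabulate (isLeader G X) v))

leaders⊆X : ∀ {n} (G : Graph n) (X : VSet n) {v : Fin n} →
  v ∈ᵇ leaders G X ≡ true → v ∈ᵇ X ≡ true
leaders⊆X G X lv = proj₁ (∧-true (leaders-isLeader G X lv))

leaders-independent : ∀ {n} (G : Graph n) (X : VSet n) → Independent G (leaders G X)
leaders-independent G X u v lu lv with <-cmp u v
... | tri≈ _ refl _ = adj-irref G u
... | tri< u<v _ _ = leader-minimal G X (leaders-isLeader G X lv) (leaders⊆X G X lu) u<v
... | tri> _ _ v<u =
  trans (adj-sym G u v) (leader-minimal G X (leaders-isLeader G X lu) (leaders⊆X G X lv) v<u)

-- In an independent X every vertex is alone in its component, so every
-- vertex of X is a leader.
leaders-of-independent : ∀ {n} (G : Graph n) (X : VSet n) → Independent G X →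
  leaders G X ≡ X
leaders-of-independent {n} G X ind =
  trans (tabulate-cong leader-iff-member) (tabulate∘lookup X)
  where
  leader-iff-member : ∀ v → isLeader G X v ≡ v ∈ᵇ X
  leader-iff-member v with v ∈ᵇ X
  ... | false = refl
  ... | true  = all-intro _ (allFin n) no-earlier
    where
    no-earlier : ∀ u → not (⌊ u <? v ⌋ ∧ connectedIn G X u v) ≡ true
    no-earlier u with connectedIn G X u v in uv
    ... | false rewrite ∧-zeroʳ ⌊ u <? v ⌋ = refl
    ... | true with refl ← independent-reach G X ind n uv
                  rewrite ⌊⌋-false (u <? u) (Fin-<-irrefl refl) = refl

components-independent : ∀ {n} (G : Graph n) (X : VSet n) → Independent G X →
  components G X ≡ card X
components-independent G X ind =
  trans (components-leaders G X) (cong card (leaders-of-independent G X ind))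

components≤α : ∀ {n} (G : Graph n) {a : ℕ} → IsIndependenceNumber G a →
  ∀ X → components G X ≤ a
components≤α G (_ , maximum) X =
  subst (_≤ _) (sym (components-leaders G X)) (maximum (leaders G X) (leaders-independent G X))

counted : ∀ {n} → Graph n → ℕ → ℕ → VSet n → Bool
counted G i j X = ⌊ card X ≟ℕ i ⌋ ∧ ⌊ components G X ≟ℕ j ⌋

Qcoeff-nonzero : ∀ {n} (G : Graph n) (X : VSet n) {i j : ℕ} →
  card X ≡ i → components G X ≡ j → Qcoeff G i j ≢ 0
Qcoeff-nonzero G X {i} {j} |X|≡i kX≡j Q≡0 =
  <-irrefl refl (subst (0 <_) Q≡0 (filter-some (λ Y → counted G i j Y ≟ true) X-listed))
  where
  X-counted : counted G i j X ≡ true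
  X-counted rewrite ⌊⌋-true (card X ≟ℕ i) |X|≡i
                  | ⌊⌋-true (components G X ≟ℕ j) kX≡j = refl
  X-listed = lose (∈-allSubsets X) X-counted

Qcoeff-zero : ∀ {n} (G : Graph n) (i j : ℕ) → (∀ X → components G X ≢ j) → Qcoeff G i j ≡ 0
Qcoeff-zero {n} G i j never =
  cong length (filter-none (λ Y → counted G i j Y ≟ true) (universal not-counted (allSubsets n)))
  where
  not-counted : ∀ X → ¬ counted G i j X ≡ true
  not-counted X c = never X (⌊⌋-sound (components G X ≟ℕ j) (proj₂ (∧-true c)))

theorem4p2 : (n : ℕ) (G : Graph n) (a : ℕ) → IsIndependenceNumber G a →
    IsDegreeY (Qcoeff G) a
theorem4p2 n G a α@((X , X-independent , |X|≡a) , _) = (a , top-coefficient) , above-vanish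
  where
  top-coefficient : Qcoeff G a a ≢ 0
  top-coefficient =
    Qcoeff-nonzero G X |X|≡a (trans (components-independent G X X-independent) |X|≡a)
  above-vanish : ∀ i j → a < j → Qcoeff G i j ≡ 0
  above-vanish i j a<j = Qcoeff-zero G i j λ Y kY≡j →
    <-irrefl refl (≤-<-trans (subst (_≤ a) kY≡j (components≤α G α Y)) a<j)
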